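{- Let $k\geq 1$, $n=8k+9$, $G=C(n,\pm\{1,2,3,4\})$, $a\in\mathbb{Z}_n$, $0\leq\ell\leq 2k+1$, and let $\varepsilon\in\{+1,-1\}$. Let $A=(A_1,A_2)$ with $A_1=\{a,a+\varepsilon\}$ and $A_2=\{a+\varepsilon(j+4\ell): j\in\{2,3,4\}\}$ (indices mod $n$), and suppose $A$ is an $S$-cluster for some $S\subseteq V(G)$. If $X\subseteq V(G)$ resolves $A$, then $|X|\geq 3$.
   Context: $C(n,\pm\{1,2,3,4\})$ is the graph on $\mathbb{Z}_n$ where distinct $i,j$ are adjacent iff $j-i\equiv\pm s\pmod n$ for some $s\in\{1,2,3,4\}$; $d$ is graph distance, and $r(v|X)=(d(v,x))_{x\in X}$ for an ordered set $X$. For $S\subseteq V$, a set $B$ is an $S$-block if $r(a|S)=r(b|S)$ for all $a,b\in B$. A tuple $(A_1,\dots,A_p)$ of $S$-blocks is an $S$-cluster if the $A_i$ are contained in distinct equivalence classes of the relation $u\sim_S v\iff r(u|S)=r(v|S)$. A set $X$ resolves a tuple $(A_1,\dots,A_p)$ if $r(a|X)\neq r(b|X)$ for all distinct $a,b$ lying in the same $A_j$. -}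

module Defs where

open import Data.Nat using (ℕ; zero; suc; _+_; _*_; _∸_; _≡ᵇ_; _<ᵇ_; NonZero)
open import Data.Nat.DivMod using (_%_; _mod_)
open import Data.Bool using (Bool; true; false; _∧_; _∨_; not; if_then_else_)
open import Data.Fin using (Fin; toℕ)
open import Data.Fin.Subset using (Subset; _∈_)
open import Data.List using (List; []; _∷_)
open import Data.Bool.ListAction using (any)
open import Data.List.Membership.Propositional renaming (_∈_ to _∈ₗ_)
open import Data.List.Relation.Unary.All using (All)
open import Data.List.Relation.Unary.AllPairs using (AllPairs)
open import Data.List using (allFin)
open import Data.Sign using (Sign)
open import Relation.Binary.PropositionalEquality using (_≡_; _≢_)
open import Relation.Nullary using (¬_)

diffMod : (n : ℕ) → .{{NonZero n}} → Fin n → Fin n → ℕ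
diffMod n i j = (toℕ j + (n ∸ toℕ i)) % n

inS : ℕ → Bool
inS m = (m ≡ᵇ 1) ∨ (m ≡ᵇ 2) ∨ (m ≡ᵇ 3) ∨ (m ≡ᵇ 4)

adj : (n : ℕ) → .{{NonZero n}} → Fin n → Fin n → Bool
adj n i j = let d = diffMod n i j in
  not (d ≡ᵇ 0) ∧ (inS d ∨ inS (n ∸ d))

ball : (n : ℕ) → .{{NonZero n}} → ℕ → Fin n → Fin n → Bool
ball n zero    u v = toℕ u ≡ᵇ toℕ v
ball n (suc t) u v =
  ball n t u v ∨ any (λ w → ball n t u w ∧ adj n w v) (allFin n)

search : (n : ℕ) → .{{NonZero n}} → Fin n → Fin n → ℕ → ℕ → ℕ
search n u v t₀ zero = t₀
search n u v t₀ (suc fuel) =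
  if ball n t₀ u v then t₀ else search n u v (suc t₀) fuel

-- graph distance d(u,v) (the graph is connected with diameter < n,
-- so searching radii 0 … n suffices)
dist : (n : ℕ) → .{{NonZero n}} → Fin n → Fin n → ℕ
dist n u v = search n u v 0 n

-- r(a|X) = r(b|X)  (componentwise equality over the elements of X;
-- the order chosen on X is irrelevant for equality)
SameRep : (n : ℕ) → .{{NonZero n}} → Subset n → Fin n → Fin n → Set
SameRep n X a b = ∀ x → x ∈ X → dist n a x ≡ dist n b x

Block : (n : ℕ) → .{{NonZero n}} → Subset n → List (Fin n) → Set
Block n S B = ∀ a b → a ∈ₗ B → b ∈ₗ B → SameRep n S a b

DistinctClasses : (n : ℕ) → .{{NonZero n}} → Subset n → List (Fin n) → List (Fin n) → Set
DistinctClasses n S B C = ∀ b c → b ∈ₗ B → c ∈ₗ C → ¬ SameRep n S b c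

Cluster : (n : ℕ) → .{{NonZero n}} → Subset n → List (List (Fin n)) → Set
Cluster n S As = All (Block n S) As × AllPairs (DistinctClasses n S) As
  where open import Data.Product using (_×_)

Resolves : (n : ℕ) → .{{NonZero n}} → Subset n → List (List (Fin n)) → Set
Resolves n X As = All (λ B → ∀ a b → a ∈ₗ B → b ∈ₗ B → a ≢ b → ¬ SameRep n X a b) As

shift : (n : ℕ) → .{{NonZero n}} → Sign → Fin n → ℕ → Fin n
shift n Sign.+ a m = (toℕ a + m) mod n
shift n Sign.- a m = (toℕ a + (n ∸ (m % n))) mod n

module Submission where

-- In C(n, ±{1,2,3,4}) the t-ball around u is the arc of vertices u + d with d ≤ 4t or n ≤ d + 4t,
-- so the distance from x to the vertex at offset d from x depends only on d, and for n ≡ 1 (mod 4)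
-- it changes between offsets d and d + 1 only when 4 ∣ d. A vertex x ∈ X separating a from a + ε
-- therefore sees a at an offset divisible by 4; then it sees a + ε(2+4ℓ) and a + ε(3+4ℓ) at offsets
-- that are not, and x separates no two vertices of A₂. A vertex separating both consecutive pairs of A₂
-- has two consecutive offsets divisible by 4, which forces them to be n − 1 and 0; the outer vertices
-- of A₂ then sit at offsets n − 1 and 1, at equal distance. So X needs two more vertices besides x.

open import Defs
open import Data.Bool using (true; false; T; not; _∧_; _∨_; if_then_else_)
open import Data.Bool.Properties using (T-∧; T-∨)
open import Data.Empty using (⊥-elim)
open import Data.Fin using (Fin; toℕ)
open import Data.Fin.Properties using (toℕ<n; toℕ-injective; toℕ-fromℕ<; ¬∀⟶∃¬) renaming (_≟_ to _≟ᶠ_)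
open import Data.Fin.Subset using (Subset; _∈_; ∣_∣; _-_)
open import Data.Fin.Subset.Properties using (_∈?_; x∈p∧x≢y⇒x∈p-y; x∈p⇒∣p-x∣<∣p∣)
open import Data.List using ([]; _∷_; allFin)
open import Data.List.Membership.Propositional.Properties using (∈-allFin)
open import Data.List.Relation.Unary.All using ([]; _∷_)
open import Data.List.Relation.Unary.Any using (here; there; satisfied)
open import Data.List.Membership.Propositional using (lose)
open import Data.List.Relation.Unary.Any.Properties using (any⁺; any⁻)
open import Data.Nat using (ℕ; zero; suc; _+_; _*_; _∸_; _≤_; _<_; z≤n; s≤s; s≤s⁻¹; z<s; s<s; _≡ᵇ_; NonZero; >-nonZero; >-nonZero⁻¹)
open import Data.Nat.DivMod
open import Data.Nat.Divisibility using (_∣_; _∣?_; _∣0; m∣m*n; ∣m+n∣m⇒∣n; ∣m∣n⇒∣m+n; ∣⇒≤)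
open import Data.Nat.Properties
open import Data.Nat.Tactic.RingSolver using (solve-∀)
open import Algebra.Properties.CommutativeSemigroup +-commutativeSemigroup
  using (x∙yz≈y∙xz; xy∙z≈xz∙y; interchange)
open import Data.Product using (∃-syntax; _×_; _,_; proj₂)
open import Data.Sign using (Sign)
open import Data.Sum using (_⊎_; inj₁; inj₂)
open import Function.Base using (_∘_)
open import Function.Bundles using (_⇔_; mk⇔; Equivalence)
open import Relation.Nullary using (¬_; yes; no; _→-dec_)
open import Relation.Binary.PropositionalEquality

module Residues (n : ℕ) {{_ : NonZero n}} where

  infix 4 _≡ₙ_
  _≡ₙ_ : ℕ → ℕ → Set
  a ≡ₙ b = a % n ≡ b % n

  %-≡ₙ : ∀ a → a % n ≡ₙ a
  %-≡ₙ a = m%n%n≡m%n a n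

  0%n≡0 : 0 % n ≡ 0
  0%n≡0 = m<n⇒m%n≡m (>-nonZero⁻¹ n)

  +n-≡ₙ : ∀ a → a + n ≡ₙ a
  +n-≡ₙ a = [m+n]%n≡m%n a n

  ≡ₙ⇒≡ : ∀ {a b} → a < n → b < n → a ≡ₙ b → a ≡ b
  ≡ₙ⇒≡ a<n b<n a≡b = trans (sym (m<n⇒m%n≡m a<n)) (trans a≡b (m<n⇒m%n≡m b<n))

  +-congʳ-≡ₙ : ∀ {a b} c → a ≡ₙ b → a + c ≡ₙ b + c
  +-congʳ-≡ₙ {a} {b} c a≡b = begin
    (a + c) % n          ≡⟨ %-distribˡ-+ a c n ⟩
    (a % n + c % n) % n  ≡⟨ cong (λ z → (z + c % n) % n) a≡b ⟩
    (b % n + c % n) % n  ≡⟨ %-distribˡ-+ b c n ⟨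
    (b + c) % n          ∎
    where open ≡-Reasoning

  +-congˡ-≡ₙ : ∀ {a b} c → a ≡ₙ b → c + a ≡ₙ c + b
  +-congˡ-≡ₙ {a} {b} c a≡b = begin
    (c + a) % n  ≡⟨ cong (_% n) (+-comm c a) ⟩
    (a + c) % n  ≡⟨ +-congʳ-≡ₙ c a≡b ⟩
    (b + c) % n  ≡⟨ cong (_% n) (+-comm b c) ⟩
    (c + b) % n  ∎
    where open ≡-Reasoning

  -ₙ_ : ℕ → ℕ
  -ₙ a = n ∸ a % n

  -ₙ-inverseˡ : ∀ a → -ₙ a + a ≡ₙ 0
  -ₙ-inverseˡ a = begin
    (-ₙ a + a) % n      ≡⟨ +-congˡ-≡ₙ (-ₙ a) (%-≡ₙ a) ⟨
    (-ₙ a + a % n) % n  ≡⟨ cong (_% n) (m∸n+n≡m (m%n≤n a n)) ⟩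
    n % n               ≡⟨ n%n≡0 n ⟩
    0                   ≡⟨ 0%n≡0 ⟨
    0 % n               ∎
    where open ≡-Reasoning

  +-cancelˡ-≡ₙ : ∀ {a b} c → c + a ≡ₙ c + b → a ≡ₙ b
  +-cancelˡ-≡ₙ {a} {b} c c+a≡c+b = begin
    a % n                 ≡⟨ +-congʳ-≡ₙ a (-ₙ-inverseˡ c) ⟨
    (-ₙ c + c + a) % n    ≡⟨ cong (_% n) (+-assoc (-ₙ c) c a) ⟩
    (-ₙ c + (c + a)) % n  ≡⟨ +-congˡ-≡ₙ (-ₙ c) c+a≡c+b ⟩
    (-ₙ c + (c + b)) % n  ≡⟨ cong (_% n) (+-assoc (-ₙ c) c b) ⟨
    (-ₙ c + c + b) % n    ≡⟨ +-congʳ-≡ₙ b (-ₙ-inverseˡ c) ⟩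
    b % n                 ∎
    where open ≡-Reasoning

  toℕ-mod : ∀ a → toℕ (a mod n) ≡ₙ a
  toℕ-mod a = trans (cong (_% n) (toℕ-fromℕ< (m%n<n a n))) (%-≡ₙ a)

  +-%-cases : ∀ {a b} → a < n → b < n → a + b ≡ (a + b) % n ⊎ a + b ≡ (a + b) % n + n
  +-%-cases {a} {b} a<n b<n with a + b <? n
  ... | yes a+b<n = inj₁ (sym (m<n⇒m%n≡m a+b<n))
  ... | no a+b≮n = inj₂ (begin
    a + b                ≡⟨ m∸n+n≡m n≤a+b ⟨
    a + b ∸ n + n        ≡⟨ cong (_+ n) (m<n⇒m%n≡m a+b∸n<n) ⟨
    (a + b ∸ n) % n + n  ≡⟨ cong (_+ n) (m≤n⇒[n∸m]%m≡n%m n≤a+b) ⟩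
    (a + b) % n + n      ∎)
    where
    open ≡-Reasoning
    n≤a+b : n ≤ a + b
    n≤a+b = ≮⇒≥ a+b≮n
    a+b∸n<n : a + b ∸ n < n
    a+b∸n<n = +-cancelʳ-< n _ n (subst (_< n + n) (sym (m∸n+n≡m n≤a+b)) (+-mono-< a<n b<n))

module Circulant (n : ℕ) {{_ : NonZero n}} where

  open Residues n

  δ : Fin n → Fin n → ℕ
  δ = diffMod n

  δ<n : ∀ u v → δ u v < n
  δ<n u v = m%n<n _ n

  δ-spec : ∀ u v → toℕ u + δ u v ≡ₙ toℕ v
  δ-spec u v = begin
    (toℕ u + δ u v) % n                  ≡⟨ +-congˡ-≡ₙ (toℕ u) (%-≡ₙ _) ⟩
    (toℕ u + (toℕ v + (n ∸ toℕ u))) % n  ≡⟨ cong (_% n) (x∙yz≈y∙xz (toℕ u) (toℕ v) _) ⟩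
    (toℕ v + (toℕ u + (n ∸ toℕ u))) % n  ≡⟨ cong (λ z → (toℕ v + z) % n) (m+[n∸m]≡n (<⇒≤ (toℕ<n u))) ⟩
    (toℕ v + n) % n                      ≡⟨ +n-≡ₙ (toℕ v) ⟩
    toℕ v % n                            ∎
    where open ≡-Reasoning

  δ-unique : ∀ {u v e} → e < n → toℕ u + e ≡ₙ toℕ v → δ u v ≡ e
  δ-unique {u} {v} e<n u+e≡v =
    ≡ₙ⇒≡ (δ<n u v) e<n (+-cancelˡ-≡ₙ (toℕ u) (trans (δ-spec u v) (sym u+e≡v)))

  δ-self : ∀ u → δ u u ≡ 0
  δ-self u = δ-unique (>-nonZero⁻¹ n) (cong (_% n) (+-identityʳ (toℕ u)))

  δ≡0⇒≡ : ∀ {u v} → δ u v ≡ 0 → u ≡ v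
  δ≡0⇒≡ {u} {v} δ≡0 = toℕ-injective (≡ₙ⇒≡ (toℕ<n u) (toℕ<n v) (begin
    toℕ u % n            ≡⟨ cong (_% n) (+-identityʳ (toℕ u)) ⟨
    (toℕ u + 0) % n      ≡⟨ cong (λ z → (toℕ u + z) % n) δ≡0 ⟨
    (toℕ u + δ u v) % n  ≡⟨ δ-spec u v ⟩
    toℕ v % n            ∎))
    where open ≡-Reasoning

  δ-trans : ∀ u w v → (δ u w + δ w v) % n ≡ δ u v
  δ-trans u w v = sym (δ-unique (m%n<n _ n) (begin
    (toℕ u + (δ u w + δ w v) % n) % n  ≡⟨ +-congˡ-≡ₙ (toℕ u) (%-≡ₙ _) ⟩
    (toℕ u + (δ u w + δ w v)) % n      ≡⟨ cong (_% n) (+-assoc (toℕ u) _ _) ⟨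
    (toℕ u + δ u w + δ w v) % n        ≡⟨ +-congʳ-≡ₙ (δ w v) (δ-spec u w) ⟩
    (toℕ w + δ w v) % n                ≡⟨ δ-spec w v ⟩
    toℕ v % n                          ∎))
    where open ≡-Reasoning

  δ-split : ∀ u w v {e} → δ u w + e ≡ δ u v → δ w v ≡ e
  δ-split u w v {e} δuw+e≡δuv = δ-unique e<n (begin
    (toℕ w + e) % n            ≡⟨ +-congʳ-≡ₙ e (δ-spec u w) ⟨
    (toℕ u + δ u w + e) % n    ≡⟨ cong (_% n) (trans (+-assoc (toℕ u) _ e) (cong (toℕ u +_) δuw+e≡δuv)) ⟩
    (toℕ u + δ u v) % n        ≡⟨ δ-spec u v ⟩
    toℕ v % n                  ∎)
    where
    open ≡-Reasoning
    e<n : e < n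
    e<n = ≤-<-trans (m≤n+m e (δ u w)) (subst (_< n) (sym δuw+e≡δuv) (δ<n u v))

  δ+δ≡ₙ0 : ∀ u v → δ u v + δ v u ≡ₙ 0
  δ+δ≡ₙ0 u v = trans (δ-trans u v u) (trans (δ-self u) (sym 0%n≡0))

  -- offset ε x u is the k < n with u = x + ε k.
  offset : Sign → Fin n → Fin n → ℕ
  offset Sign.+ x u = δ x u
  offset Sign.- x u = δ u x

  offset<n : ∀ ε x u → offset ε x u < n
  offset<n Sign.+ x u = δ<n x u
  offset<n Sign.- x u = δ<n u x

  offset-self : ∀ ε a → offset ε a a ≡ 0
  offset-self Sign.+ a = δ-self a
  offset-self Sign.- a = δ-self a

  offset-shift : ∀ ε x a j → offset ε x (shift n ε a j) ≡ (offset ε x a + j) % n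
  offset-shift Sign.+ x a j = δ-unique (m%n<n _ n) (begin
    (toℕ x + (δ x a + j) % n) % n  ≡⟨ +-congˡ-≡ₙ (toℕ x) (%-≡ₙ _) ⟩
    (toℕ x + (δ x a + j)) % n      ≡⟨ cong (_% n) (+-assoc (toℕ x) _ j) ⟨
    (toℕ x + δ x a + j) % n        ≡⟨ +-congʳ-≡ₙ j (δ-spec x a) ⟩
    (toℕ a + j) % n                ≡⟨ toℕ-mod (toℕ a + j) ⟨
    toℕ ((toℕ a + j) mod n) % n    ∎)
    where open ≡-Reasoning
  offset-shift Sign.- x a j = δ-unique (m%n<n _ n) (begin
    (toℕ s + (δ a x + j) % n) % n       ≡⟨ +-congˡ-≡ₙ (toℕ s) (%-≡ₙ _) ⟩
    (toℕ s + (δ a x + j)) % n           ≡⟨ +-congʳ-≡ₙ (δ a x + j) (toℕ-mod (toℕ a + -ₙ j)) ⟩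
    (toℕ a + -ₙ j + (δ a x + j)) % n    ≡⟨ cong (_% n) (interchange (toℕ a) (-ₙ j) (δ a x) j) ⟩
    (toℕ a + δ a x + (-ₙ j + j)) % n    ≡⟨ +-congʳ-≡ₙ (-ₙ j + j) (δ-spec a x) ⟩
    (toℕ x + (-ₙ j + j)) % n            ≡⟨ +-congˡ-≡ₙ (toℕ x) (-ₙ-inverseˡ j) ⟩
    (toℕ x + 0) % n                     ≡⟨ cong (_% n) (+-identityʳ (toℕ x)) ⟩
    toℕ x % n                           ∎)
    where
    open ≡-Reasoning
    s : Fin n
    s = shift n Sign.- a j

  offset-shift-self : ∀ ε a {j} → j < n → offset ε a (shift n ε a j) ≡ j
  offset-shift-self ε a {j} j<n = begin
    offset ε a (shift n ε a j)  ≡⟨ offset-shift ε a a j ⟩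
    (offset ε a a + j) % n      ≡⟨ cong (λ z → (z + j) % n) (offset-self ε a) ⟩
    j % n                       ≡⟨ m<n⇒m%n≡m j<n ⟩
    j                           ∎
    where open ≡-Reasoning

  shift-injective : ∀ ε a {i j} → i < n → j < n → shift n ε a i ≡ shift n ε a j → i ≡ j
  shift-injective ε a {i} {j} i<n j<n eq = begin
    i                           ≡⟨ offset-shift-self ε a i<n ⟨
    offset ε a (shift n ε a i)  ≡⟨ cong (offset ε a) eq ⟩
    offset ε a (shift n ε a j)  ≡⟨ offset-shift-self ε a j<n ⟩
    j                           ∎
    where open ≡-Reasoning

  <⇒shift≢ : ∀ ε a {i j} → i < j → j < n → shift n ε a i ≢ shift n ε a j
  <⇒shift≢ ε a i<j j<n = <⇒≢ i<j ∘ shift-injective ε a (<-trans i<j j<n) j<n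

  a≢shift : ∀ ε a {j} → 0 < j → j < n → a ≢ shift n ε a j
  a≢shift ε a 0<j j<n a≡shift = <⇒≢ 0<j (begin
    0                           ≡⟨ offset-self ε a ⟨
    offset ε a a                ≡⟨ cong (offset ε a) a≡shift ⟩
    offset ε a (shift n ε a _)  ≡⟨ offset-shift-self ε a j<n ⟩
    _                           ∎)
    where open ≡-Reasoning

  offset-shift-suc : ∀ ε x a j → offset ε x (shift n ε a (suc j)) ≡ (offset ε x (shift n ε a j) + 1) % n
  offset-shift-suc ε x a j = begin
    offset ε x (shift n ε a (suc j))         ≡⟨ offset-shift ε x a (suc j) ⟩
    (offset ε x a + suc j) % n               ≡⟨ cong (_% n) (trans (+-suc _ j) (+-comm 1 (offset ε x a + j))) ⟩
    (offset ε x a + j + 1) % n               ≡⟨ +-congʳ-≡ₙ 1 (%-≡ₙ (offset ε x a + j)) ⟨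
    ((offset ε x a + j) % n + 1) % n         ≡⟨ cong (λ o → (o + 1) % n) (offset-shift ε x a j) ⟨
    (offset ε x (shift n ε a j) + 1) % n     ∎
    where open ≡-Reasoning

  Near : ℕ → ℕ → Set
  Near r d = d ≤ r ⊎ n ≤ d + r

  Near-mono : ∀ {r r' d} → r ≤ r' → Near r d → Near r' d
  Near-mono r≤r' (inj₁ d≤r)   = inj₁ (≤-trans d≤r r≤r')
  Near-mono r≤r' (inj₂ n≤d+r) = inj₂ (≤-trans n≤d+r (+-monoʳ-≤ _ r≤r'))

  Near-+ : ∀ {r s a b} → a < n → b < n → Near r a → Near s b → Near (r + s) ((a + b) % n)
  Near-+ {r} {s} {a} {b} a<n b<n near-a near-b with +-%-cases a<n b<n | near-a | near-b
  ... | inj₁ a+b≡g | inj₁ a≤r | inj₁ b≤s = inj₁ (subst (_≤ r + s) a+b≡g (+-mono-≤ a≤r b≤s))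
  ... | inj₁ a+b≡g | inj₂ n≤a+r | _ =
    inj₂ (≤-trans n≤a+r (subst (λ g → a + r ≤ g + (r + s)) a+b≡g (+-mono-≤ (m≤m+n a b) (m≤m+n r s))))
  ... | inj₁ a+b≡g | inj₁ _ | inj₂ n≤b+s =
    inj₂ (≤-trans n≤b+s (subst (λ g → b + s ≤ g + (r + s)) a+b≡g (+-mono-≤ (m≤n+m b a) (m≤n+m s r))))
  ... | inj₂ a+b≡g+n | inj₁ a≤r | _ =
    inj₁ (≤-trans (<⇒≤ (+-cancelʳ-< n _ a (subst (_< a + n) a+b≡g+n (+-monoʳ-< a b<n))))
                  (≤-trans a≤r (m≤m+n r s)))
  ... | inj₂ a+b≡g+n | inj₂ _ | inj₁ b≤s =
    inj₁ (≤-trans (<⇒≤ (+-cancelʳ-< n _ b (subst (_< b + n) (trans (+-comm b a) a+b≡g+n) (+-monoʳ-< b a<n))))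
                  (≤-trans b≤s (m≤n+m s r)))
  ... | inj₂ a+b≡g+n | inj₂ n≤a+r | inj₂ n≤b+s = inj₂ (+-cancelʳ-≤ n n _ (begin
    n + n                    ≤⟨ +-mono-≤ n≤a+r n≤b+s ⟩
    a + r + (b + s)          ≡⟨ interchange a r b s ⟩
    a + b + (r + s)          ≡⟨ cong (_+ (r + s)) a+b≡g+n ⟩
    (a + b) % n + n + (r + s) ≡⟨ xy∙z≈xz∙y ((a + b) % n) n (r + s) ⟩
    (a + b) % n + (r + s) + n ∎))
    where open ≤-Reasoning

  Near-flip : ∀ {r a b} → a + b ≡ n → Near r a → Near r b
  Near-flip {r} {a} {b} a+b≡n (inj₁ a≤r) =
    inj₂ (subst (_≤ b + r) a+b≡n (subst (a + b ≤_) (+-comm r b) (+-monoˡ-≤ b a≤r)))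
  Near-flip {r} {a} {b} a+b≡n (inj₂ n≤a+r) =
    inj₁ (+-cancelˡ-≤ a b r (subst (_≤ a + r) (sym a+b≡n) n≤a+r))

  Near-neg : ∀ {r a b} → a < n → b < n → a + b ≡ₙ 0 → Near r a → Near r b
  Near-neg {r} {a} {b} a<n b<n a+b≡0 with +-%-cases a<n b<n
  ... | inj₁ a+b≡[a+b]%n = subst (Near r) (trans (m+n≡0⇒m≡0 a a+b≡0') (sym (m+n≡0⇒n≡0 a a+b≡0')))
    where
    a+b≡0' : a + b ≡ 0
    a+b≡0' = trans a+b≡[a+b]%n (trans a+b≡0 0%n≡0)
  ... | inj₂ a+b≡[a+b]%n+n = Near-flip (trans a+b≡[a+b]%n+n (cong (_+ n) (trans a+b≡0 0%n≡0)))

  Near-δ-comm : ∀ {r} u v → Near r (δ u v) → Near r (δ v u)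
  Near-δ-comm u v = Near-neg (δ<n u v) (δ<n v u) (δ+δ≡ₙ0 u v)

  Equidistant : ℕ → ℕ → Set
  Equidistant d d' = ∀ t → Near (4 * t) d ⇔ Near (4 * t) d'

  Equidistant-neg : ∀ {a b} → a < n → b < n → a + b ≡ₙ 0 → Equidistant a b
  Equidistant-neg {a} {b} a<n b<n a+b≡0 t =
    mk⇔ (Near-neg a<n b<n a+b≡0) (Near-neg b<n a<n (trans (cong (_% n) (+-comm b a)) a+b≡0))

  inS⇒≤4 : ∀ m → T (inS m) → m ≤ 4
  inS⇒≤4 1 _ = s≤s z≤n
  inS⇒≤4 2 _ = s≤s (s≤s z≤n)
  inS⇒≤4 3 _ = s≤s (s≤s (s≤s z≤n))
  inS⇒≤4 4 _ = ≤-refl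

  inS-intro : ∀ m → 1 ≤ m → m ≤ 4 → T (inS m)
  inS-intro 1 _ _ = _
  inS-intro 2 _ _ = _
  inS-intro 3 _ _ = _
  inS-intro 4 _ _ = _
  inS-intro (suc (suc (suc (suc (suc _))))) _ (s≤s (s≤s (s≤s (s≤s ()))))

  adj⇒Near : ∀ w v → T (adj n w v) → Near 4 (δ w v)
  adj⇒Near w v w~v with Equivalence.to T-∨ (proj₂ (Equivalence.to T-∧ w~v))
  ... | inj₁ inS-d   = inj₁ (inS⇒≤4 (δ w v) inS-d)
  ... | inj₂ inS-n∸d =
    inj₂ (≤-trans (m≤n+m∸n n (δ w v)) (+-monoʳ-≤ (δ w v) (inS⇒≤4 (n ∸ δ w v) inS-n∸d)))

  adj-intro : ∀ w v → 1 ≤ δ w v → Near 4 (δ w v) → T (adj n w v)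
  adj-intro w v = residue-adjacent (δ w v) (δ<n w v)
    where
    residue-adjacent : ∀ d → d < n → 1 ≤ d → Near 4 d → T (not (d ≡ᵇ 0) ∧ (inS d ∨ inS (n ∸ d)))
    residue-adjacent (suc d) _ 1≤d (inj₁ d≤4) = Equivalence.from T-∨ (inj₁ (inS-intro (suc d) 1≤d d≤4))
    residue-adjacent (suc d) d<n _ (inj₂ n≤d+4) =
      Equivalence.from (T-∨ {inS (suc d)})
        (inj₂ (inS-intro (n ∸ suc d) (m<n⇒0<n∸m d<n) (m≤n+o⇒m∸n≤o n (suc d) n≤d+4)))

  4[1+t]≡4t+4 : ∀ t → 4 * suc t ≡ 4 * t + 4
  4[1+t]≡4t+4 t = trans (*-suc 4 t) (+-comm 4 (4 * t))

  ball⇒Near : ∀ t u v → T (ball n t u v) → Near (4 * t) (δ u v)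
  ball⇒Near zero u v u≡ᵇv = inj₁ (≤-reflexive (trans (cong (δ u) (sym u≡v)) (δ-self u)))
    where
    u≡v : u ≡ v
    u≡v = toℕ-injective (≡ᵇ⇒≡ (toℕ u) (toℕ v) u≡ᵇv)
  ball⇒Near (suc t) u v in-ball with Equivalence.to (T-∨ {ball n t u v}) in-ball
  ... | inj₁ in-smaller = Near-mono (≤-trans (m≤m+n (4 * t) 4) (≤-reflexive (sym (4[1+t]≡4t+4 t))))
                                    (ball⇒Near t u v in-smaller)
  ... | inj₂ via-neighbour with satisfied (any⁻ _ (allFin n) via-neighbour)
  ...   | w , in-ball-w∧w~v with Equivalence.to T-∧ in-ball-w∧w~v
  ...     | in-ball-w , w~v = subst₂ Near (sym (4[1+t]≡4t+4 t)) (δ-trans u w v)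
                                (Near-+ (δ<n u w) (δ<n w v) (ball⇒Near t u w in-ball-w) (adj⇒Near w v w~v))

  forward-neighbour : ∀ t u v → 4 * t < δ u v → δ u v ≤ 4 * t + 4 →
                      ∃[ w ] Near (4 * t) (δ u w) × T (adj n w v)
  forward-neighbour t u v 4t<δ δ≤4t+4 =
    w , inj₁ (≤-reflexive δuw≡4t) ,
    adj-intro w v (subst (1 ≤_) (sym δwv≡δ∸4t) (m<n⇒0<n∸m 4t<δ))
                  (inj₁ (subst (_≤ 4) (sym δwv≡δ∸4t) (m≤n+o⇒m∸n≤o (δ u v) (4 * t) δ≤4t+4)))
    where
    w : Fin n
    w = shift n Sign.+ u (4 * t)
    δuw≡4t : δ u w ≡ 4 * t
    δuw≡4t = offset-shift-self Sign.+ u (<-trans 4t<δ (δ<n u v))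
    δwv≡δ∸4t : δ w v ≡ δ u v ∸ 4 * t
    δwv≡δ∸4t = δ-split u w v (trans (cong (_+ (δ u v ∸ 4 * t)) δuw≡4t) (m+[n∸m]≡n (<⇒≤ 4t<δ)))

  backward-neighbour : ∀ t u v → 4 * t < δ u v → δ u v + 4 * t < n → n ≤ δ u v + 4 * t + 4 →
                       ∃[ w ] Near (4 * t) (δ u w) × T (adj n w v)
  backward-neighbour t u v 4t<δ δ+4t<n n≤δ+4t+4 =
    w , Near-δ-comm w u (inj₁ (≤-reflexive δwu≡4t)) ,
    adj-intro w v (subst (1 ≤_) (sym δwv≡δ+4t) (≤-trans (<-≤-trans z<s 4t<δ) (m≤m+n (δ u v) (4 * t))))
                  (inj₂ (subst (λ d → n ≤ d + 4) (sym δwv≡δ+4t) n≤δ+4t+4))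
    where
    w : Fin n
    w = shift n Sign.- u (4 * t)
    δwu≡4t : δ w u ≡ 4 * t
    δwu≡4t = offset-shift-self Sign.- u (≤-<-trans (m≤n+m (4 * t) (δ u v)) δ+4t<n)
    δwv≡δ+4t : δ w v ≡ δ u v + 4 * t
    δwv≡δ+4t = begin
      δ w v                    ≡⟨ δ-trans w u v ⟨
      (δ w u + δ u v) % n      ≡⟨ cong (λ d → (d + δ u v) % n) δwu≡4t ⟩
      (4 * t + δ u v) % n      ≡⟨ cong (_% n) (+-comm (4 * t) (δ u v)) ⟩
      (δ u v + 4 * t) % n      ≡⟨ m<n⇒m%n≡m δ+4t<n ⟩
      δ u v + 4 * t            ∎
      where open ≡-Reasoning

  closer-neighbour : ∀ t u v → 4 * t < δ u v → δ u v + 4 * t < n → Near (4 * suc t) (δ u v) →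
                     ∃[ w ] Near (4 * t) (δ u w) × T (adj n w v)
  closer-neighbour t u v 4t<δ δ+4t<n near with subst (λ r → Near r (δ u v)) (4[1+t]≡4t+4 t) near
  ... | inj₁ δ≤4t+4   = forward-neighbour t u v 4t<δ δ≤4t+4
  ... | inj₂ n≤δ+4t+4 =
    backward-neighbour t u v 4t<δ δ+4t<n (subst (n ≤_) (sym (+-assoc (δ u v) (4 * t) 4)) n≤δ+4t+4)

  ball-step : ∀ t u w v → T (ball n t u w) → T (adj n w v) → T (ball n (suc t) u v)
  ball-step t u w v in-ball-w w~v = Equivalence.from (T-∨ {ball n t u v})
    (inj₂ (any⁺ _ (lose (∈-allFin w) (Equivalence.from T-∧ (in-ball-w , w~v)))))

  Near⇒ball : ∀ t u v → Near (4 * t) (δ u v) → T (ball n t u v)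
  Near⇒ball zero u v (inj₁ δ≤0) = ≡⇒≡ᵇ (toℕ u) (toℕ v) (cong toℕ (δ≡0⇒≡ (n≤0⇒n≡0 δ≤0)))
  Near⇒ball zero u v (inj₂ n≤δ+0) = ⊥-elim (<⇒≱ (δ<n u v) (subst (n ≤_) (+-identityʳ _) n≤δ+0))
  Near⇒ball (suc t) u v near with δ u v ≤? 4 * t | n ≤? δ u v + 4 * t
  ... | yes δ≤4t | _ = Equivalence.from T-∨ (inj₁ (Near⇒ball t u v (inj₁ δ≤4t)))
  ... | no _ | yes n≤δ+4t = Equivalence.from T-∨ (inj₁ (Near⇒ball t u v (inj₂ n≤δ+4t)))
  ... | no δ≰4t | no n≰δ+4t with closer-neighbour t u v (≰⇒> δ≰4t) (≰⇒> n≰δ+4t) near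
  ...   | w , near-w , w~v = ball-step t u w v (Near⇒ball t u w near-w) w~v

  T-injective : ∀ {a b} → (T a → T b) → (T b → T a) → a ≡ b
  T-injective {false} {false} _ _ = refl
  T-injective {false} {true}  _ b⇒a = ⊥-elim (b⇒a _)
  T-injective {true}  {false} a⇒b _ = ⊥-elim (a⇒b _)
  T-injective {true}  {true}  _ _ = refl

  search-cong : ∀ {u v u' v'} → (∀ t → ball n t u v ≡ ball n t u' v') →
                ∀ t₀ fuel → search n u v t₀ fuel ≡ search n u' v' t₀ fuel
  search-cong same-balls t₀ zero = refl
  search-cong same-balls t₀ (suc fuel) =
    cong₂ (λ b r → if b then t₀ else r) (same-balls t₀) (search-cong same-balls (suc t₀) fuel)

  dist-cong : ∀ {u v u' v'} → Equidistant (δ u v) (δ u' v') → dist n u v ≡ dist n u' v'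
  dist-cong {u} {v} {u'} {v'} equidistant = search-cong same-balls 0 n
    where
    same-balls : ∀ t → ball n t u v ≡ ball n t u' v'
    same-balls t = T-injective
      (λ in-ball → Near⇒ball t u' v' (Equivalence.to (equidistant t) (ball⇒Near t u v in-ball)))
      (λ in-ball → Near⇒ball t u v (Equivalence.from (equidistant t) (ball⇒Near t u' v' in-ball)))

  dist-comm : ∀ u v → dist n u v ≡ dist n v u
  dist-comm u v = dist-cong (Equidistant-neg (δ<n u v) (δ<n v u) (δ+δ≡ₙ0 u v))

  dist-offset : ∀ ε x {u u'} → Equidistant (offset ε x u) (offset ε x u') → dist n u x ≡ dist n u' x
  dist-offset Sign.+ x {u} {u'} equidistant = begin
    dist n u x   ≡⟨ dist-comm u x ⟩
    dist n x u   ≡⟨ dist-cong equidistant ⟩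
    dist n x u'  ≡⟨ dist-comm x u' ⟩
    dist n u' x  ∎
    where open ≡-Reasoning
  dist-offset Sign.- x equidistant = dist-cong equidistant

3≤∣p∣ : ∀ {n} {p : Subset n} {x y z : Fin n} → x ∈ p → y ∈ p → z ∈ p →
        x ≢ y → x ≢ z → y ≢ z → 3 ≤ ∣ p ∣
3≤∣p∣ {p = p} {x} {y} {z} x∈p y∈p z∈p x≢y x≢z y≢z =
  <-≤-trans (s<s (<-≤-trans (s<s (<-≤-trans z<s ∣p-x-y-z∣<∣p-x-y∣)) ∣p-x-y∣<∣p-x∣)) ∣p-x∣<∣p∣
  where
  ∣p-x∣<∣p∣ : ∣ p - x ∣ < ∣ p ∣
  ∣p-x∣<∣p∣ = x∈p⇒∣p-x∣<∣p∣ x∈p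
  ∣p-x-y∣<∣p-x∣ : ∣ p - x - y ∣ < ∣ p - x ∣
  ∣p-x-y∣<∣p-x∣ = x∈p⇒∣p-x∣<∣p∣ (x∈p∧x≢y⇒x∈p-y y∈p (x≢y ∘ sym))
  ∣p-x-y-z∣<∣p-x-y∣ : ∣ p - x - y - z ∣ < ∣ p - x - y ∣
  ∣p-x-y-z∣<∣p-x-y∣ =
    x∈p⇒∣p-x∣<∣p∣ (x∈p∧x≢y⇒x∈p-y (x∈p∧x≢y⇒x∈p-y z∈p (x≢z ∘ sym)) (y≢z ∘ sym))

module Resolving (n : ℕ) {{_ : NonZero n}} where

  Separates : Fin n → Fin n → Fin n → Set
  Separates x u v = dist n u x ≢ dist n v x

  separator : ∀ X u v → ¬ SameRep n X u v → ∃[ x ] x ∈ X × Separates x u v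
  separator X u v ¬same with ¬∀⟶∃¬ n _ (λ x → (x ∈? X) →-dec (dist n u x ≟ dist n v x)) ¬same
  ... | x , ¬[x∈X⇒same] with x ∈? X
  ...   | yes x∈X = x , x∈X , λ same → ¬[x∈X⇒same] (λ _ → same)
  ...   | no x∉X = ⊥-elim (¬[x∈X⇒same] (λ x∈X → ⊥-elim (x∉X x∈X)))

  resolves-triple-with-blind-vertex⇒3≤∣X∣ :
    ∀ {X x p q r} → x ∈ X → dist n p x ≡ dist n q x → dist n q x ≡ dist n r x →
    (∀ y → Separates y p q → Separates y q r → dist n p y ≡ dist n r y) →
    ¬ SameRep n X p q → ¬ SameRep n X q r → ¬ SameRep n X p r → 3 ≤ ∣ X ∣
  resolves-triple-with-blind-vertex⇒3≤∣X∣ {X} {p = p} {q} {r} x∈X x-pq x-qr no-double-separator ¬pq ¬qr ¬pr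
    with separator X p q ¬pq | separator X q r ¬qr | separator X p r ¬pr
  ... | y , y∈X , y-pq | z , z∈X , z-qr | w , w∈X , w-pr with y ≟ᶠ z
  ...   | no y≢z = 3≤∣p∣ x∈X y∈X z∈X (λ { refl → y-pq x-pq }) (λ { refl → z-qr x-qr }) y≢z
  ...   | yes refl = 3≤∣p∣ x∈X y∈X w∈X (λ { refl → y-pq x-pq }) (λ { refl → w-pr (trans x-pq x-qr) })
                            (λ { refl → w-pr (no-double-separator y y-pq z-qr) })

¬4∣r+4t : ∀ {r} t → 0 < r → r < 4 → ¬ 4 ∣ r + 4 * t
¬4∣r+4t {r} t 0<r r<4 4∣r+4t = <⇒≱ r<4 (∣⇒≤ {{>-nonZero 0<r}} 4∣r)
  where
  4∣r : 4 ∣ r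
  4∣r = ∣m+n∣m⇒∣n (subst (4 ∣_) (+-comm r (4 * t)) 4∣r+4t) (m∣m*n t)

module OneModFour (n : ℕ) {{_ : NonZero n}} (m : ℕ) (n≡1+4m : n ≡ 1 + 4 * m) where

  open Residues n
  open Circulant n
  open Resolving n

  y+1+4t≡n⇒4∣y : ∀ {y} t → y + 1 + 4 * t ≡ n → 4 ∣ y
  y+1+4t≡n⇒4∣y {y} t y+1+4t≡n =
    ∣m+n∣m⇒∣n (subst (4 ∣_) (sym 4t+y≡4m) (m∣m*n m)) (m∣m*n t)
    where
    4t+y≡4m : 4 * t + y ≡ 4 * m
    4t+y≡4m = suc-injective (begin
      suc (4 * t + y)    ≡⟨ cong suc (+-comm (4 * t) y) ⟩
      1 + (y + 4 * t)    ≡⟨ +-assoc 1 y (4 * t) ⟨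
      1 + y + 4 * t      ≡⟨ cong (_+ 4 * t) (+-comm 1 y) ⟩
      y + 1 + 4 * t      ≡⟨ y+1+4t≡n ⟩
      n                  ≡⟨ n≡1+4m ⟩
      1 + 4 * m          ∎)
      where open ≡-Reasoning

  y+1≡n⇒4∣y : ∀ {y} → y + 1 ≡ n → 4 ∣ y
  y+1≡n⇒4∣y {y} y+1≡n = y+1+4t≡n⇒4∣y 0 (trans (+-identityʳ (y + 1)) y+1≡n)

  equidistant-suc : ∀ {y} → y < n → ¬ 4 ∣ y → Equidistant y ((y + 1) % n)
  equidistant-suc {y} y<n 4∤y with m≤n⇒m<n∨m≡n (subst (_≤ n) (+-comm 1 y) y<n)
  ... | inj₂ y+1≡n = ⊥-elim (4∤y (y+1≡n⇒4∣y y+1≡n))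
  ... | inj₁ y+1<n rewrite m<n⇒m%n≡m y+1<n = λ t → mk⇔ (to t) (from t)
    where
    to : ∀ t → Near (4 * t) y → Near (4 * t) (y + 1)
    to t (inj₁ y≤4t) with m≤n⇒m<n∨m≡n y≤4t
    ... | inj₁ y<4t  = inj₁ (subst (_≤ 4 * t) (+-comm 1 y) y<4t)
    ... | inj₂ y≡4t = ⊥-elim (4∤y (subst (4 ∣_) (sym y≡4t) (m∣m*n t)))
    to t (inj₂ n≤y+4t) = inj₂ (≤-trans n≤y+4t (+-monoˡ-≤ (4 * t) (m≤m+n y 1)))
    from : ∀ t → Near (4 * t) (y + 1) → Near (4 * t) y
    from t (inj₁ y+1≤4t) = inj₁ (≤-trans (m≤m+n y 1) y+1≤4t)
    from t (inj₂ n≤y+1+4t) with m≤n⇒m<n∨m≡n n≤y+1+4t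
    ... | inj₁ n<y+1+4t = inj₂ (s≤s⁻¹ (subst (suc n ≤_) (cong (_+ 4 * t) (+-comm y 1)) n<y+1+4t))
    ... | inj₂ n≡y+1+4t = ⊥-elim (4∤y (y+1+4t≡n⇒4∣y t (sym n≡y+1+4t)))

  equidistant-wrap : ∀ {y} → y < n → 4 ∣ y → 4 ∣ (y + 1) % n → Equidistant y (((y + 1) % n + 1) % n)
  equidistant-wrap {y} y<n 4∣y 4∣[y+1]%n with m≤n⇒m<n∨m≡n (subst (_≤ n) (+-comm 1 y) y<n)
  ... | inj₁ y+1<n = ⊥-elim (¬4∣r+4t 0 (s≤s z≤n) (s≤s (s≤s z≤n))
                       (∣m+n∣m⇒∣n (subst (4 ∣_) (m<n⇒m%n≡m y+1<n) 4∣[y+1]%n) 4∣y))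
  ... | inj₂ y+1≡n = Equidistant-neg y<n (m%n<n _ n) (begin
    (y + ((y + 1) % n + 1) % n) % n  ≡⟨ +-congˡ-≡ₙ y (%-≡ₙ _) ⟩
    (y + ((y + 1) % n + 1)) % n      ≡⟨ cong (λ z → (y + (z + 1)) % n) [y+1]%n≡0 ⟩
    (y + 1) % n                      ≡⟨ [y+1]%n≡0 ⟩
    0                                ≡⟨ 0%n≡0 ⟨
    0 % n                            ∎)
    where
    open ≡-Reasoning
    [y+1]%n≡0 : (y + 1) % n ≡ 0
    [y+1]%n≡0 = trans (cong (_% n) y+1≡n) (n%n≡0 n)

  4∤[E+j]%n : ∀ {E j} → 4 ∣ E → E < n → j < n → ¬ 4 ∣ j → ¬ 4 ∣ j ∸ 1 → ¬ 4 ∣ (E + j) % n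
  4∤[E+j]%n {E} {zero} _ _ _ 4∤j _ _ = 4∤j (4 ∣0)
  4∤[E+j]%n {E} {j@(suc j-1)} 4∣E E<n j<n 4∤j 4∤j∸1 4∣[E+j]%n with +-%-cases E<n j<n
  ... | inj₁ E+j≡[E+j]%n = 4∤j (∣m+n∣m⇒∣n (subst (4 ∣_) (sym E+j≡[E+j]%n) 4∣[E+j]%n) 4∣E)
  ... | inj₂ E+j≡[E+j]%n+n = 4∤j∸1 (∣m+n∣m⇒∣n 4∣E+j-1 4∣E)
    where
    E+j-1≡[E+j]%n+4m : E + j-1 ≡ (E + j) % n + 4 * m
    E+j-1≡[E+j]%n+4m = suc-injective (begin
      suc (E + j-1)              ≡⟨ +-suc E j-1 ⟨
      E + j                      ≡⟨ E+j≡[E+j]%n+n ⟩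
      (E + j) % n + n            ≡⟨ cong ((E + j) % n +_) n≡1+4m ⟩
      (E + j) % n + (1 + 4 * m)  ≡⟨ +-suc _ (4 * m) ⟩
      suc ((E + j) % n + 4 * m)  ∎)
      where open ≡-Reasoning
    4∣E+j-1 : 4 ∣ E + j-1
    4∣E+j-1 = subst (4 ∣_) (sym E+j-1≡[E+j]%n+4m) (∣m∣n⇒∣m+n 4∣[E+j]%n (m∣m*n m))

  dist-step : ∀ ε x {u u'} → offset ε x u' ≡ (offset ε x u + 1) % n → ¬ 4 ∣ offset ε x u →
              dist n u x ≡ dist n u' x
  dist-step ε x {u} u'-follows-u 4∤ =
    dist-offset ε x (subst (Equidistant _) (sym u'-follows-u) (equidistant-suc (offset<n ε x u) 4∤))

  separates-step⇒4∣ : ∀ ε x {u u'} → offset ε x u' ≡ (offset ε x u + 1) % n → Separates x u u' →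
                      4 ∣ offset ε x u
  separates-step⇒4∣ ε x {u} u'-follows-u x-separates with 4 ∣? offset ε x u
  ... | yes 4∣ = 4∣
  ... | no 4∤ = ⊥-elim (x-separates (dist-step ε x u'-follows-u 4∤))

  separates-twice⇒dist-ends : ∀ ε y {u u' u''} →
    offset ε y u' ≡ (offset ε y u + 1) % n → offset ε y u'' ≡ (offset ε y u' + 1) % n →
    Separates y u u' → Separates y u' u'' → dist n u y ≡ dist n u'' y
  separates-twice⇒dist-ends ε y {u} u'-follows-u u''-follows-u' separates₁ separates₂ =
    dist-offset ε y (subst (Equidistant _) (sym (trans u''-follows-u' (cong (λ o → (o + 1) % n) u'-follows-u)))
      (equidistant-wrap (offset<n ε y u) (separates-step⇒4∣ ε y u'-follows-u separates₁)
        (subst (4 ∣_) u'-follows-u (separates-step⇒4∣ ε y u''-follows-u' separates₂))))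

  4∤offset-shift : ∀ ε a x {j} → 4 ∣ offset ε x a → j < n → ¬ 4 ∣ j → ¬ 4 ∣ j ∸ 1 →
                   ¬ 4 ∣ offset ε x (shift n ε a j)
  4∤offset-shift ε a x {j} 4∣ j<n 4∤j 4∤j∸1 =
    subst (¬_ ∘ (4 ∣_)) (sym (offset-shift ε x a j)) (4∤[E+j]%n 4∣ (offset<n ε x a) j<n 4∤j 4∤j∸1)

  separates-a-a+ε⇒4∣ : ∀ ε a x → Separates x a (shift n ε a 1) → 4 ∣ offset ε x a
  separates-a-a+ε⇒4∣ ε a x = separates-step⇒4∣ ε x (offset-shift ε x a 1)

  module Configuration (ε : Sign) (a : Fin n) (ℓ : ℕ) (4+4ℓ<n : 4 + 4 * ℓ < n) where

    3+4ℓ<n : 3 + 4 * ℓ < n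
    3+4ℓ<n = <-trans (n<1+n _) 4+4ℓ<n

    2+4ℓ<n : 2 + 4 * ℓ < n
    2+4ℓ<n = <-trans (n<1+n _) 3+4ℓ<n

    4∣offset⇒dist₂≡dist₃ : ∀ x → 4 ∣ offset ε x a →
                           dist n (shift n ε a (2 + 4 * ℓ)) x ≡ dist n (shift n ε a (3 + 4 * ℓ)) x
    4∣offset⇒dist₂≡dist₃ x 4∣ =
      dist-step ε x {shift n ε a (2 + 4 * ℓ)} {shift n ε a (3 + 4 * ℓ)} (offset-shift-suc ε x a (2 + 4 * ℓ))
        (4∤offset-shift ε a x 4∣ 2+4ℓ<n (¬4∣r+4t ℓ z<s (s<s (s<s z<s))) (¬4∣r+4t ℓ z<s (s<s z<s)))

    4∣offset⇒dist₃≡dist₄ : ∀ x → 4 ∣ offset ε x a →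
                           dist n (shift n ε a (3 + 4 * ℓ)) x ≡ dist n (shift n ε a (4 + 4 * ℓ)) x
    4∣offset⇒dist₃≡dist₄ x 4∣ =
      dist-step ε x {shift n ε a (3 + 4 * ℓ)} {shift n ε a (4 + 4 * ℓ)} (offset-shift-suc ε x a (3 + 4 * ℓ))
        (4∤offset-shift ε a x 4∣ 3+4ℓ<n (¬4∣r+4t ℓ z<s (s<s (s<s (s<s z<s))))
                                         (¬4∣r+4t ℓ z<s (s<s (s<s z<s))))

    separates₂₃∧₃₄⇒dist₂≡dist₄ : ∀ y →
      Separates y (shift n ε a (2 + 4 * ℓ)) (shift n ε a (3 + 4 * ℓ)) →
      Separates y (shift n ε a (3 + 4 * ℓ)) (shift n ε a (4 + 4 * ℓ)) →
      dist n (shift n ε a (2 + 4 * ℓ)) y ≡ dist n (shift n ε a (4 + 4 * ℓ)) y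
    separates₂₃∧₃₄⇒dist₂≡dist₄ y =
      separates-twice⇒dist-ends ε y
        {shift n ε a (2 + 4 * ℓ)} {shift n ε a (3 + 4 * ℓ)} {shift n ε a (4 + 4 * ℓ)}
        (offset-shift-suc ε y a (2 + 4 * ℓ)) (offset-shift-suc ε y a (3 + 4 * ℓ))

    a≢a+ε : a ≢ shift n ε a 1
    a≢a+ε = a≢shift ε a z<s (≤-<-trans (s≤s z≤n) 2+4ℓ<n)

    2+4ℓ≢3+4ℓ : shift n ε a (2 + 4 * ℓ) ≢ shift n ε a (3 + 4 * ℓ)
    2+4ℓ≢3+4ℓ = <⇒shift≢ ε a (n<1+n _) 3+4ℓ<n

    3+4ℓ≢4+4ℓ : shift n ε a (3 + 4 * ℓ) ≢ shift n ε a (4 + 4 * ℓ)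
    3+4ℓ≢4+4ℓ = <⇒shift≢ ε a (n<1+n _) 4+4ℓ<n

    2+4ℓ≢4+4ℓ : shift n ε a (2 + 4 * ℓ) ≢ shift n ε a (4 + 4 * ℓ)
    2+4ℓ≢4+4ℓ = <⇒shift≢ ε a (<-trans (n<1+n _) (n<1+n _)) 4+4ℓ<n

9+8k≡1+4[2+2k] : ∀ k → 9 + 8 * k ≡ 1 + 4 * (2 + 2 * k)
9+8k≡1+4[2+2k] = solve-∀

4+4[2k+1]≡8+8k : ∀ k → 4 + 4 * (2 * k + 1) ≡ 8 + 8 * k
4+4[2k+1]≡8+8k = solve-∀

lemma3p6 : (k : ℕ) → 1 ≤ k → (a : Fin (9 + 8 * k)) → (ℓ : ℕ) → ℓ ≤ 2 * k + 1 →
    (ε : Sign) → (S : Subset (9 + 8 * k)) →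
    Cluster (9 + 8 * k) S
      ((a ∷ shift (9 + 8 * k) ε a 1 ∷ []) ∷
       (shift (9 + 8 * k) ε a (2 + 4 * ℓ) ∷ shift (9 + 8 * k) ε a (3 + 4 * ℓ) ∷
        shift (9 + 8 * k) ε a (4 + 4 * ℓ) ∷ []) ∷ []) →
    (X : Subset (9 + 8 * k)) →
    Resolves (9 + 8 * k)  X
      ((a ∷ shift (9 + 8 * k) ε a 1 ∷ []) ∷
       (shift (9 + 8 * k) ε a (2 + 4 * ℓ) ∷ shift (9 + 8 * k) ε a (3 + 4 * ℓ) ∷
        shift (9 + 8 * k) ε a (4 + 4 * ℓ) ∷ []) ∷ []) →
    3 ≤ ∣ X ∣
lemma3p6 k _ a ℓ ℓ≤2k+1 ε _ _ X (resolves₁ ∷ resolves₂ ∷ []) =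
  -- let, not where: the names must be inlined, since comparing distinct dist terms unfolds its search exponentially.
  let n = 9 + 8 * k
      a+ε = shift n ε a 1
      c₂ = shift n ε a (2 + 4 * ℓ)
      c₃ = shift n ε a (3 + 4 * ℓ)
      c₄ = shift n ε a (4 + 4 * ℓ)
      x , x∈X , x-separates = separator X a a+ε (resolves₁ a a+ε (here refl) (there (here refl)) a≢a+ε)
      4∣offset-x = separates-a-a+ε⇒4∣ ε a x x-separates
  in resolves-triple-with-blind-vertex⇒3≤∣X∣ {p = c₂} {c₃} {c₄} x∈X
       (4∣offset⇒dist₂≡dist₃ x 4∣offset-x) (4∣offset⇒dist₃≡dist₄ x 4∣offset-x)
       separates₂₃∧₃₄⇒dist₂≡dist₄
       (resolves₂ c₂ c₃ (here refl) (there (here refl)) 2+4ℓ≢3+4ℓ)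
       (resolves₂ c₃ c₄ (there (here refl)) (there (there (here refl))) 3+4ℓ≢4+4ℓ)
       (resolves₂ c₂ c₄ (here refl) (there (there (here refl))) 2+4ℓ≢4+4ℓ)
  where
  open Resolving (9 + 8 * k)
  open OneModFour (9 + 8 * k) (2 + 2 * k) (9+8k≡1+4[2+2k] k)
  open Configuration ε a ℓ
    (s≤s (≤-trans (+-monoʳ-≤ 4 (*-monoʳ-≤ 4 ℓ≤2k+1)) (≤-reflexive (4+4[2k+1]≡8+8k k))))
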